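{- Let $\mathbb{F}$ be a field of positive characteristic $p$, let $X$ be a nonempty finite set and let $S=\{R_0,\dots,R_d\}$ be an association scheme on $X$ with thin thin residue, i.e. $O^\vartheta(S)\subseteq O_\vartheta(S)$. Then $S$ is $p$-transitive if and only if $S=\langle S_{p'}\rangle$, where $S_{p'}=\{R_i\in S: p\nmid k_i\}$.
   Context: An association scheme on $X$ is a partition $S=\{R_0,\dots,R_d\}$ of $X\times X$ into nonempty relations such that $R_0=\{(x,x):x\in X\}$; for each $i$ the relation $\{(y,x):(x,y)\in R_i\}$ equals some $R_{i^*}\in S$; and for all $i,j,k$ the number $p_{ij}^k=|\{z\in X:(x,z)\in R_i,(z,y)\in R_j\}|$ does not depend on the choice of $(x,y)\in R_k$. The valency of $R_i$ is $k_i=p_{ii^*}^0$. For nonempty $U,V\subseteq S$, $UV=\{R_k:\exists R_u\in U,R_v\in V,\ p_{uv}^k>0\}$. A nonempty $T\subseteq S$ is closed if $T^*T\subseteq T$ with $T^*=\{R_{i^*}:R_i\in T\}$; strongly normal if also $R_{i^*}TR_i\subseteq T$ for all $i$. For $H\subseteq S$, $\langle H\rangle$ is the intersection of all closed subsets of $S$ containing $H$. $O_\vartheta(S)=\{R_i:k_i=1\}$ (thin radical); $O^\vartheta(S)$ is the intersection of all strongly normal closed subsets (thin residue). Let $A_i$ be the adjacency matrix of $R_i$, $\overline{A_i}$ its image in $M_X(\mathbb{F})$, and $\mathbb{F}S=\mathrm{span}_{\mathbb{F}}\{\overline{A_0},\dots,\overline{A_d}\}$, an algebra with this basis. A trivial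 submodule of the regular $\mathbb{F}S$-module is $\langle v\rangle_{\mathbb{F}}$ with $0\neq v\in\mathbb{F}S$ and $\overline{A_i}v=\overline{k_i}v$ for all $i$ ($\overline{k_i}$ the image of $k_i$ in $\mathbb{F}$). $S$ is $p$-transitive if the regular $\mathbb{F}S$-module has exactly one trivial submodule. -}

module Defs where

open import Level using (Level; _⊔_)
open import Data.Nat as ℕ using (ℕ; zero; suc; _<_)
open import Data.Fin using (Fin; zero; suc; _≟_)
open import Data.Bool using (Bool; true; false; _∧_; if_then_else_)
open import Data.Product using (Σ; ∃; ∃-syntax; Σ-syntax; _×_; _,_)
open import Relation.Nullary using (¬_)
open import Relation.Nullary.Decidable using (⌊_⌋)
open import Relation.Binary.PropositionalEquality using (_≡_)
open import Algebra.Bundles using (CommutativeRing)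

record Field (c ℓ : Level) : Set (Level.suc (c ⊔ ℓ)) where
  field
    commutativeRing : CommutativeRing c ℓ
  open CommutativeRing commutativeRing public
  field
    1≉0     : ¬ (1# ≈ 0#)
    inverse : ∀ x → ¬ (x ≈ 0#) → ∃[ y ] (x * y ≈ 1#)

module FieldOps {c ℓ : Level} (F : Field c ℓ) where
  open Field F using (Carrier; _≈_; _+_; _*_; 0#; 1#)

  ι : ℕ → Carrier
  ι zero    = 0#
  ι (suc n) = 1# + ι n

  HasCharacteristic : ℕ → Set ℓ
  HasCharacteristic p =
    (0 < p) × (ι p ≈ 0#) × (∀ m → 0 < m → m < p → ¬ (ι m ≈ 0#))

  sumF : ∀ {n} → (Fin n → Carrier) → Carrier
  sumF {zero}  f = 0#
  sumF {suc n} f = f zero + sumF (λ i → f (suc i))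

count : ∀ {n} → (Fin n → Bool) → ℕ
count {zero}  f = 0
count {suc n} f = (if f zero then 1 else 0) ℕ.+ count (λ i → f (suc i))

-- Association schemes on X = Fin n with relations R_0, …, R_d indexed
-- by Fin (suc d).  The partition is given by the function r : (x,y) ↦ i
-- with (x,y) ∈ R_i.

record AssocScheme (n d : ℕ) : Set where
  field
    r        : Fin n → Fin n → Fin (suc d)
    nonempty : ∀ i → ∃[ x ] ∃[ y ] (r x y ≡ i)
    R₀-diag₁ : ∀ x y → r x y ≡ zero → x ≡ y
    R₀-diag₂ : ∀ x → r x x ≡ zero
    star     : Fin (suc d) → Fin (suc d)
    star-spec : ∀ x y → r y x ≡ star (r x y)
    p        : Fin (suc d) → Fin (suc d) → Fin (suc d) → ℕ
    p-spec   : ∀ i j k x y → r x y ≡ k →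
               count (λ z → ⌊ r x z ≟ i ⌋ ∧ ⌊ r z y ≟ j ⌋) ≡ p i j k

  valency : Fin (suc d) → ℕ
  valency i = p i (star i) zero

  SubS : Set₁
  SubS = Fin (suc d) → Set

  _⊆S_ : SubS → SubS → Set
  U ⊆S V = ∀ i → U i → V i

  Prod : SubS → SubS → SubS
  Prod U V k = ∃[ u ] ∃[ v ] (U u × V v × 0 < p u v k)

  StarSet : SubS → SubS
  StarSet T j = ∃[ u ] (T u × j ≡ star u)

  Singleton : Fin (suc d) → SubS
  Singleton i j = j ≡ i

  Closed : SubS → Set
  Closed T = (∃[ i ] T i) × (Prod (StarSet T) T ⊆S T)

  StronglyNormalClosed : SubS → Set
  StronglyNormalClosed T =
    Closed T × (∀ i → Prod (Prod (Singleton (star i)) T) (Singleton i) ⊆S T)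

  Generated : SubS → Fin (suc d) → Set₁
  Generated H i = ∀ (T : SubS) → Closed T → H ⊆S T → T i

  ThinRadical : SubS
  ThinRadical i = valency i ≡ 1

  ThinResidue : Fin (suc d) → Set₁
  ThinResidue i = ∀ (T : SubS) → StronglyNormalClosed T → T i

  ThinThinResidue : Set₁
  ThinThinResidue = ∀ i → ThinResidue i → ThinRadical i

  module OverField {c ℓ : Level} (F : Field c ℓ) where
    open Field F using (Carrier; _≈_; _+_; _*_; 0#; 1#)
    open FieldOps F

    Mat : Set c
    Mat = Fin n → Fin n → Carrier

    adj : Fin (suc d) → Mat
    adj i x y = if ⌊ r x y ≟ i ⌋ then 1# else 0#

    _·M_ : Mat → Mat → Mat
    (M ·M N) x y = sumF (λ z → M x z * N z y)

    InFS : Mat → Set (c ⊔ ℓ)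
    InFS M = Σ[ a ∈ (Fin (suc d) → Carrier) ] (∀ x y → M x y ≈ sumF (λ i → a i * adj i x y))

    -- v spans a trivial submodule of the regular 𝔽S-module
    TrivialVector : Mat → Set (c ⊔ ℓ)
    TrivialVector v =
      InFS v × ¬ (∀ x y → v x y ≈ 0#) ×
      (∀ i x y → (adj i ·M v) x y ≈ ι (valency i) * v x y)

    SameSpan : Mat → Mat → Set (c ⊔ ℓ)
    SameSpan v w =
      (∀ a → ∃[ b ] (∀ x y → a * v x y ≈ b * w x y)) ×
      (∀ b → ∃[ a ] (∀ x y → b * w x y ≈ a * v x y))

    -- exactly one trivial submodule
    PTransitive : Set (c ⊔ ℓ)
    PTransitive =
      ∃[ v ] (TrivialVector v × (∀ w → TrivialVector w → SameSpan w v))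

-- Let w span a trivial submodule and p ∤ kᵢ.  Any two i-neighbours of x are joined by a
-- relation of the thin residue, hence by a thin relation, so w(z,y) is the same for all
-- i-neighbours z of x; then (Aᵢ w)(x,y) equals both kᵢ w(x,y) and kᵢ w(z,y), and kᵢ ≠ 0
-- in 𝔽 gives w(z,y) = w(x,y).  The relations along which w is invariant in this sense
-- form a closed subset containing S_{p′}, so if ⟨S_{p′}⟩ = S then w is a multiple of the
-- all-ones matrix J.  Conversely, for a closed T ⊇ S_{p′} the same computation shows
-- that the indicator matrix of T spans a trivial submodule (both sides vanish when
-- p ∣ kᵢ); if J spans the only one, that indicator is constant, i.e. T = S.

module Submission where

open import Defs
open import Level using (Level; _⊔_)
open import Data.Nat using (ℕ; _<_)
open import Data.Nat.Divisibility using (_∣_)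
open import Data.Product using (_×_)
open import Function.Bundles using (_⇔_)
open import Relation.Nullary using (¬_)

open import Data.Nat as ℕ using (zero; suc; _≤_; z≤n; s≤s; z<s; _<?_; NonZero; >-nonZero)
open import Data.Nat.Properties
  using (≤-trans; ≤-reflexive; <-≤-trans; <⇒≱; ≤-pred; m≤n⇒m≤1+n; m≤m+n; +-suc; +-monoʳ-≤)
open import Data.Nat.Divisibility using (divides; _∣?_; n∣m*n; m%n≡0⇒n∣m)
open import Data.Nat.DivMod using (_%_; _/_; m≡m%n+[m/n]*n; m%n<n)
open import Data.Fin using (Fin; zero; suc; _≟_)
open import Data.Fin.Properties using (any?)
open import Data.Bool using (Bool; true; false; T; _∧_; _∨_; if_then_else_)
open import Data.Bool.Properties using (T-≡; T-∧; T-∨)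
open import Data.Unit using (tt)
open import Data.Empty using (⊥-elim)
open import Data.Product using (∃; _,_; proj₁; proj₂)
open import Data.Sum using (inj₁; inj₂; [_,_])
open import Function using (_∘_; Equivalence; mk⇔)
open import Relation.Nullary using (Dec; yes; no; contradiction)
open import Relation.Nullary.Decidable
  using (⌊_⌋; toWitness; fromWitness; decidable-stable; T?; ¬?; _×-dec_; _⊎-dec_)
open import Relation.Unary using (Decidable)
open import Relation.Binary.PropositionalEquality using (_≡_; refl; sym; trans; cong; cong₂; subst)

if-T : ∀ {a} {A : Set a} {b} {x y : A} → T b → (if b then x else y) ≡ x
if-T {b = true} _ = refl

if-¬T : ∀ {a} {A : Set a} {b} {x y : A} → ¬ T b → (if b then x else y) ≡ y
if-¬T {b = true}  ¬t = contradiction tt ¬t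
if-¬T {b = false} _  = refl

∃⇒count>0 : ∀ {m} (f : Fin m → Bool) {i} → T (f i) → 0 < count f
∃⇒count>0 f {zero} fi with f zero
... | true  = z<s
... | false = ⊥-elim fi
∃⇒count>0 f {suc i} fi with f zero
... | true  = z<s
... | false = ∃⇒count>0 (f ∘ suc) fi

count>0⇒∃ : ∀ {m} (f : Fin m → Bool) → 0 < count f → ∃ λ i → T (f i)
count>0⇒∃ {suc m} f pos with f zero in f₀
... | true  = zero , subst T (sym f₀) tt
... | false = let i , fi = count>0⇒∃ (f ∘ suc) pos in suc i , fi

count-cong : ∀ {m} {f g : Fin m → Bool} → (∀ i → f i ≡ g i) → count f ≡ count g
count-cong {zero}  _   = refl
count-cong {suc m} f≗g =
  cong₂ ℕ._+_ (cong (λ b → if b then 1 else 0) (f≗g zero)) (count-cong (f≗g ∘ suc))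

count≤size : ∀ {m} (f : Fin m → Bool) → count f ≤ m
count≤size {zero}  f = z≤n
count≤size {suc m} f with f zero
... | true  = s≤s (count≤size (f ∘ suc))
... | false = m≤n⇒m≤1+n (count≤size (f ∘ suc))

count-mono : ∀ {m} (f g : Fin m → Bool) → (∀ {i} → T (f i) → T (g i)) → count f ≤ count g
count-mono {zero}  f g _ = z≤n
count-mono {suc m} f g f⊆g with f zero in f₀ | g zero in g₀
... | true  | true  = s≤s (count-mono (f ∘ suc) (g ∘ suc) f⊆g)
... | true  | false = ⊥-elim (subst T g₀ (f⊆g (subst T (sym f₀) tt)))
... | false | true  = m≤n⇒m≤1+n (count-mono (f ∘ suc) (g ∘ suc) f⊆g)
... | false | false = count-mono (f ∘ suc) (g ∘ suc) f⊆g

count-strictMono : ∀ {m} (f g : Fin m → Bool) → (∀ {i} → T (f i) → T (g i)) →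
                   ∀ {j} → T (g j) → ¬ T (f j) → count f < count g
count-strictMono f g f⊆g {zero} gj ¬fj with f zero | g zero
... | true  | _     = contradiction tt ¬fj
... | false | true  = s≤s (count-mono (f ∘ suc) (g ∘ suc) f⊆g)
... | false | false = ⊥-elim gj
count-strictMono f g f⊆g {suc j} gj ¬fj with f zero in f₀ | g zero in g₀
... | true  | true  = s≤s (count-strictMono (f ∘ suc) (g ∘ suc) f⊆g gj ¬fj)
... | true  | false = ⊥-elim (subst T g₀ (f⊆g (subst T (sym f₀) tt)))
... | false | true  = m≤n⇒m≤1+n (count-strictMono (f ∘ suc) (g ∘ suc) f⊆g gj ¬fj)
... | false | false = count-strictMono (f ∘ suc) (g ∘ suc) f⊆g gj ¬fj

-- Removing i from f leaves a subset with a true entry at j ≢ i, of size < count f ≤ 1.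
count≤1⇒unique : ∀ {m} (f : Fin m → Bool) → count f ≤ 1 → ∀ {i j} → T (f i) → T (f j) → i ≡ j
count≤1⇒unique f count≤1 {i} {j} fi fj with i ≟ j
... | yes i≡j = i≡j
... | no  i≢j = ⊥-elim (<⇒≱ (∃⇒count>0 f∖i f∖i-j) (≤-pred (≤-trans smaller count≤1)))
  where
  f∖i : Fin _ → Bool
  f∖i k = f k ∧ ⌊ ¬? (k ≟ i) ⌋

  f∖i-j : T (f∖i j)
  f∖i-j = Equivalence.from T-∧ (fj , fromWitness {a? = ¬? (j ≟ i)} (i≢j ∘ sym))

  smaller : count f∖i < count f
  smaller = count-strictMono f∖i f (proj₁ ∘ Equivalence.to T-∧) fi
              (λ f∖i-i → toWitness {a? = ¬? (i ≟ i)} (proj₂ (Equivalence.to T-∧ f∖i-i)) refl)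

count-≟ : ∀ {m} (j : Fin m) → count (λ i → ⌊ j ≟ i ⌋) ≡ 1
count-≟ {suc m} zero = cong suc (count-false m)
  where
  count-false : ∀ m → count (λ (_ : Fin m) → false) ≡ 0
  count-false zero    = refl
  count-false (suc m) = count-false m
count-≟ {suc (suc m)} (suc j) = trans (count-cong (suc≟suc j)) (count-≟ j)
  where
  suc≟suc : ∀ {m} (x y : Fin m) → ⌊ suc x ≟ suc y ⌋ ≡ ⌊ x ≟ y ⌋
  suc≟suc x y with x ≟ y
  ... | yes _ = refl
  ... | no  _ = refl

module _ {m : ℕ} (step : (Fin m → Bool) → Fin m → Bool)
         (step-inflationary : ∀ D {i} → T (D i) → T (step D i)) where

  Prefixed : (Fin m → Bool) → Set
  Prefixed D = ∀ {i} → T (step D i) → T (D i)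

  -- Every proper step adds an element, so m + 1 rounds suffice.
  prefixed-from : ∀ {a} (P : (Fin m → Bool) → Set a) → (∀ {D} → P D → P (step D)) →
                  ∀ {D} → P D → ∃ λ D′ → P D′ × Prefixed D′
  prefixed-from P P-step {D} = iterate (suc m) (m≤m+n (suc m) (count D))
    where
    iterate : ∀ fuel {D} → m < fuel ℕ.+ count D → P D → ∃ λ D′ → P D′ × Prefixed D′
    iterate zero {D} bound _ = ⊥-elim (<⇒≱ bound (count≤size D))
    iterate (suc fuel) {D} bound PD
      with any? (λ i → T? (step D i) ×-dec ¬? (T? (D i)))
    ... | yes (i , new , ¬old) = iterate fuel bound′ (P-step PD)
      where
      bound′ : m < fuel ℕ.+ count (step D)
      bound′ = <-≤-trans bound
                 (≤-trans (≤-reflexive (sym (+-suc fuel (count D))))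
                          (+-monoʳ-≤ fuel (count-strictMono D (step D) (step-inflationary D) new ¬old)))
    ... | no none = D , PD , λ {i} new →
      decidable-stable (T? (D i)) (λ ¬old → none (i , new , ¬old))

module FieldProperties {c ℓ} (𝔽 : Field c ℓ) where
  open Field 𝔽 hiding (zero) renaming (refl to ≈-refl; sym to ≈-sym; trans to ≈-trans)
  open FieldOps 𝔽
  open import Relation.Binary.Reasoning.Setoid setoid
  open import Algebra.Properties.Semiring.Mult semiring using (×-homo-+; ×1-homo-*)
    renaming (_×_ to _·ℕ_)

  sumF-cong : ∀ {m} {f g : Fin m → Carrier} → (∀ i → f i ≈ g i) → sumF f ≈ sumF g
  sumF-cong {zero}  _   = ≈-refl
  sumF-cong {suc m} f≈g = +-cong (f≈g zero) (sumF-cong (f≈g ∘ suc))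

  sumF-select : ∀ {m} (b : Fin m → Bool) (g : Fin m → Carrier) {a} → (∀ i → T (b i) → g i ≈ a) →
                sumF (λ i → (if b i then 1# else 0#) * g i) ≈ ι (count b) * a
  sumF-select {zero}  b g {a} _ = ≈-sym (zeroˡ a)
  sumF-select {suc m} b g {a} g≈a with b zero | g≈a zero
  ... | true  | g₀≈a = begin
    1# * g zero + _      ≈⟨ +-cong (*-congˡ (g₀≈a tt)) rest ⟩
    1# * a + ι k * a     ≈⟨ distribʳ a 1# (ι k) ⟨
    (1# + ι k) * a       ∎
    where
    k : ℕ
    k = count (b ∘ suc)
    rest : sumF (λ i → (if b (suc i) then 1# else 0#) * g (suc i)) ≈ ι k * a
    rest = sumF-select (b ∘ suc) (g ∘ suc) (g≈a ∘ suc)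
  ... | false | _    = ≈-trans (+-cong (zeroˡ (g zero)) (sumF-select (b ∘ suc) (g ∘ suc) (g≈a ∘ suc)))
                                (+-identityˡ _)

  ι≡·ℕ1 : ∀ k → ι k ≡ k ·ℕ 1#
  ι≡·ℕ1 zero    = refl
  ι≡·ℕ1 (suc k) = cong (1# +_) (ι≡·ℕ1 k)

  ι-homo-+ : ∀ j k → ι (j ℕ.+ k) ≈ ι j + ι k
  ι-homo-+ j k rewrite ι≡·ℕ1 (j ℕ.+ k) | ι≡·ℕ1 j | ι≡·ℕ1 k = ×-homo-+ 1# j k

  ι-homo-* : ∀ j k → ι (j ℕ.* k) ≈ ι j * ι k
  ι-homo-* j k rewrite ι≡·ℕ1 (j ℕ.* k) | ι≡·ℕ1 j | ι≡·ℕ1 k = ×1-homo-* j k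

  ι-1 : ι 1 ≈ 1#
  ι-1 = +-identityʳ 1#

  *-cancelˡ : ∀ {a x y} → ¬ a ≈ 0# → a * x ≈ a * y → x ≈ y
  *-cancelˡ {a} {x} {y} a≉0 ax≈ay with inverse a a≉0
  ... | a⁻¹ , aa⁻¹≈1 = ≈-trans (≈-sym (a⁻¹-cancels x)) (≈-trans (*-congˡ ax≈ay) (a⁻¹-cancels y))
    where
    a⁻¹-cancels : ∀ z → a⁻¹ * (a * z) ≈ z
    a⁻¹-cancels z = begin
      a⁻¹ * (a * z)  ≈⟨ *-assoc a⁻¹ a z ⟨
      (a⁻¹ * a) * z  ≈⟨ *-congʳ (≈-trans (*-comm a⁻¹ a) aa⁻¹≈1) ⟩
      1# * z         ≈⟨ *-identityˡ z ⟩
      z              ∎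

  module Characteristic {p : ℕ} (char : HasCharacteristic p) where

    instance
      p-nonZero : NonZero p
      p-nonZero = >-nonZero (proj₁ char)

    p∣⇒ι≈0 : ∀ {k} → p ∣ k → ι k ≈ 0#
    p∣⇒ι≈0 {k} (divides q refl) = begin
      ι (q ℕ.* p)  ≈⟨ ι-homo-* q p ⟩
      ι q * ι p    ≈⟨ *-congˡ (proj₁ (proj₂ char)) ⟩
      ι q * 0#     ≈⟨ zeroʳ (ι q) ⟩
      0#           ∎

    p∣⇒ι*-absorbs : ∀ {k} → p ∣ k → ∀ x y → ι k * x ≈ ι k * y
    p∣⇒ι*-absorbs {k} p∣k x y = begin
      ι k * x  ≈⟨ *-congʳ (p∣⇒ι≈0 p∣k) ⟩
      0# * x   ≈⟨ zeroˡ x ⟩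
      0#       ≈⟨ zeroˡ y ⟨
      0# * y   ≈⟨ *-congʳ (p∣⇒ι≈0 p∣k) ⟨
      ι k * y  ∎

    ι-mod : ∀ k → ι (k % p) ≈ ι k
    ι-mod k = begin
      ι (k % p)                    ≈⟨ +-identityʳ _ ⟨
      ι (k % p) + 0#               ≈⟨ +-congˡ (p∣⇒ι≈0 (n∣m*n (k / p))) ⟨
      ι (k % p) + ι (k / p ℕ.* p)  ≈⟨ ι-homo-+ (k % p) _ ⟨
      ι (k % p ℕ.+ k / p ℕ.* p)    ≡⟨ cong ι (m≡m%n+[m/n]*n k p) ⟨
      ι k                          ∎

    -- k % p is a natural number below p with the same image as k.
    p∤⇒ι≉0 : ∀ {k} → ¬ p ∣ k → ¬ ι k ≈ 0#
    p∤⇒ι≉0 {k} p∤k ιk≈0 with k % p in k%p≡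
    ... | zero  = p∤k (m%n≡0⇒n∣m k p k%p≡)
    ... | suc r = proj₂ (proj₂ char) (suc r) z<s (subst (_< p) k%p≡ (m%n<n k p))
                    (subst (λ j → ι j ≈ 0#) k%p≡ (≈-trans (ι-mod k) ιk≈0))

    p∤1 : ¬ p ∣ 1
    p∤1 p∣1 = 1≉0 (≈-trans (≈-sym ι-1) (p∣⇒ι≈0 p∣1))

module SchemeProperties {n d : ℕ} (S : AssocScheme n d) where
  open AssocScheme S

  star-involutive : ∀ i → star (star i) ≡ i
  star-involutive i with nonempty i
  ... | x , y , refl = trans (cong star (sym (star-spec x y))) (sym (star-spec y x))

  r-flip : ∀ {x z i} → r x z ≡ i → r z x ≡ star i
  r-flip {x} {z} refl = star-spec x z

  path⇒p>0 : ∀ {x y z i j} → r x z ≡ i → r z y ≡ j → 0 < p i j (r x y)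
  path⇒p>0 {x} {y} {z} refl refl = subst (0 <_) (p-spec (r x z) (r z y) (r x y) x y refl)
    (∃⇒count>0 _ {z} (Equivalence.from T-∧ ( fromWitness {a? = r x z ≟ r x z} refl
                                            , fromWitness {a? = r z y ≟ r z y} refl)))

  p>0⇒path : ∀ {x y i j k} → 0 < p i j k → r x y ≡ k → ∃ λ z → r x z ≡ i × r z y ≡ j
  p>0⇒path {x} {y} {i} {j} {k} p>0 xy∈k
    with count>0⇒∃ _ (subst (0 <_) (sym (p-spec i j k x y xy∈k)) p>0)
  ... | z , z∈ = z , toWitness {a? = r x z ≟ i} (proj₁ (Equivalence.to T-∧ z∈))
                   , toWitness {a? = r z y ≟ j} (proj₂ (Equivalence.to T-∧ z∈))

  p-unit : ∀ i → 0 < p i zero i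
  p-unit i with nonempty i
  ... | x , y , refl = path⇒p>0 refl (R₀-diag₂ y)

  count-neighbours : ∀ x i → count (λ z → ⌊ r x z ≟ i ⌋) ≡ valency i
  count-neighbours x i =
    trans (count-cong there-and-back) (p-spec i (star i) zero x x (R₀-diag₂ x))
    where
    there-and-back : ∀ z → ⌊ r x z ≟ i ⌋ ≡ (⌊ r x z ≟ i ⌋ ∧ ⌊ r z x ≟ star i ⌋)
    there-and-back z with r x z ≟ i
    ... | yes xz∈i = sym (Equivalence.to T-≡ (fromWitness {a? = r z x ≟ star i} (r-flip xz∈i)))
    ... | no  _    = refl

  neighbour-exists : ∀ x i → ∃ λ z → r x z ≡ i
  neighbour-exists x i with nonempty i
  ... | x₀ , y₀ , x₀y₀∈i with count>0⇒∃ (λ z → ⌊ r x z ≟ i ⌋) (subst (0 <_) same-count x₀-has-one)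
    where
    same-count : count (λ z → ⌊ r x₀ z ≟ i ⌋) ≡ count (λ z → ⌊ r x z ≟ i ⌋)
    same-count = trans (count-neighbours x₀ i) (sym (count-neighbours x i))
    x₀-has-one : 0 < count (λ z → ⌊ r x₀ z ≟ i ⌋)
    x₀-has-one = ∃⇒count>0 _ {y₀} (fromWitness {a? = r x₀ y₀ ≟ i} x₀y₀∈i)
  ... | z , xz∈i = z , toWitness {a? = r x z ≟ i} xz∈i

  thin-unique : ∀ {t z u u′} → valency t ≡ 1 → r z u ≡ t → r z u′ ≡ t → u ≡ u′
  thin-unique {t} {z} {u} {u′} thin zu∈t zu′∈t =
    count≤1⇒unique (λ v → ⌊ r z v ≟ t ⌋) (≤-reflexive (trans (count-neighbours z t) thin))
      (fromWitness {a? = r z u ≟ t} zu∈t) (fromWitness {a? = r z u′ ≟ t} zu′∈t)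

  ProductClosed : ∀ {a} → (Fin (suc d) → Set a) → Set a
  ProductClosed P = ∀ {u v k} → P u → P v → 0 < p (star u) v k → P k

  Closed⇒ProductClosed : ∀ {P} → Closed P → ProductClosed P
  Closed⇒ProductClosed (_ , P*P⊆P) Pu Pv p>0 = P*P⊆P _ (_ , _ , (_ , Pu , refl) , Pv , p>0)

  ProductClosed⇒Closed : ∀ {P : SubS} {i} → P i → ProductClosed P → Closed P
  ProductClosed⇒Closed Pi closed =
    (_ , Pi) , λ { _ (_ , _ , (_ , Pu , refl) , Pv , p>0) → closed Pu Pv p>0 }

  module _ {a} {P : Fin (suc d) → Set a} (closed : ProductClosed P) where

    productClosed-R₀ : ∀ {i} → P i → P zero
    productClosed-R₀ {i} Pi with nonempty i
    ... | x , y , refl = subst P (R₀-diag₂ y) (closed Pi Pi (path⇒p>0 (r-flip refl) refl))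

    productClosed-star : P zero → ∀ {i} → P i → P (star i)
    productClosed-star P₀ Pi = closed Pi P₀ (p-unit (star _))

    productClosed-path : P zero → ∀ {x y z} → P (r x z) → P (r z y) → P (r x y)
    productClosed-path P₀ {x} {y} {z} Pxz Pzy =
      closed (subst P (sym (star-spec x z)) (productClosed-star P₀ Pxz)) Pzy
             (path⇒p>0 (star-spec z x) refl)

  Closed⇒R₀ : ∀ {P} → Closed P → P zero
  Closed⇒R₀ P-closed = productClosed-R₀ (Closed⇒ProductClosed P-closed) (proj₂ (proj₁ P-closed))

  productClosed-left-invariant : ∀ {D : Fin (suc d) → Bool} → ProductClosed (T ∘ D) → T (D zero) →
                                 ∀ {x y z} → T (D (r x z)) → D (r z y) ≡ D (r x y)
  productClosed-left-invariant {D} closed D₀ {x} {y} {z} Dxz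
    with D (r z y) in Dzy | D (r x y) in Dxy
  ... | true  | true  = refl
  ... | false | false = refl
  ... | true  | false = ⊥-elim (subst T Dxy (productClosed-path closed D₀ Dxz (subst T (sym Dzy) tt)))
  ... | false | true  = ⊥-elim (subst T Dzy (productClosed-path closed D₀ Dzx (subst T (sym Dxy) tt)))
    where
    Dzx : T (D (r z x))
    Dzx = subst (T ∘ D) (sym (star-spec x z)) (productClosed-star closed D₀ Dxz)

  product? : (D : Fin (suc d) → Bool) (k : Fin (suc d)) →
             Dec (∃ λ u → ∃ λ v → T (D u) × T (D v) × 0 < p (star u) v k)
  product? D k = any? λ u → any? λ v → T? (D u) ×-dec T? (D v) ×-dec 0 <? p (star u) v k

  closureStep : (Fin (suc d) → Bool) → Fin (suc d) → Bool
  closureStep D k = D k ∨ ⌊ product? D k ⌋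

  closureStep-inflationary : ∀ D {k} → T (D k) → T (closureStep D k)
  closureStep-inflationary D Dk = Equivalence.from T-∨ (inj₁ Dk)

  closureStep-product : ∀ D {u v k} → T (D u) → T (D v) → 0 < p (star u) v k → T (closureStep D k)
  closureStep-product D {u} {v} {k} Du Dv p>0 =
    Equivalence.from T-∨ (inj₂ (fromWitness {a? = product? D k} (u , v , Du , Dv , p>0)))

  closureStep-within : ∀ {a} {P : Fin (suc d) → Set a} → ProductClosed P →
                       ∀ {D} → (∀ {j} → T (D j) → P j) → ∀ {k} → T (closureStep D k) → P k
  closureStep-within closed {D} D⊆P {k} Dk′ =
    [ D⊆P , (λ (_ , _ , Du , Dv , p>0) → closed (D⊆P Du) (D⊆P Dv) p>0) ∘ toWitness {a? = product? D k} ]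
      (Equivalence.to T-∨ Dk′)

  -- Boolean, so that its indicator matrix is definable, and built inside a product-closed P of
  -- any universe, since Generated only quantifies over subsets in Set.
  record ClosureWithin {h a} (H : Fin (suc d) → Set h) (P : Fin (suc d) → Set a) : Set (h ⊔ a) where
    field
      member : Fin (suc d) → Bool
      ⊇H     : ∀ {j} → H j → T (member j)
      has-R₀ : T (member zero)
      closed : ProductClosed (T ∘ member)
      ⊆P     : ∀ {j} → T (member j) → P j

  -- Opaque because unfolding the iteration makes type checking of its uses very slow.
  opaque
    closure-within : ∀ {h a} {H : Fin (suc d) → Set h} {P : Fin (suc d) → Set a} → Decidable H →
                     ProductClosed P → P zero → (∀ {j} → H j → P j) → ClosureWithin H P
    closure-within {h} {a} {H} {P} H? P-closed P₀ H⊆P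
      with prefixed-from closureStep closureStep-inflationary Invariant preserved initial-invariant
      where
      Invariant : (Fin (suc d) → Bool) → Set (h ⊔ a)
      Invariant D = (∀ {j} → H j → T (D j)) × T (D zero) × (∀ {j} → T (D j) → P j)

      preserved : ∀ {D} → Invariant D → Invariant (closureStep D)
      preserved {D} (H⊆D , D₀ , D⊆P) =
        closureStep-inflationary D ∘ H⊆D , closureStep-inflationary D D₀ , closureStep-within P-closed D⊆P

      initial : Fin (suc d) → Bool
      initial j = ⌊ H? j ⊎-dec j ≟ zero ⌋

      initial-invariant : Invariant initial
      initial-invariant =
          (λ {j} Hj → fromWitness {a? = H? j ⊎-dec j ≟ zero} (inj₁ Hj))
        , fromWitness {a? = H? zero ⊎-dec zero ≟ zero} (inj₂ refl)
        , λ {j} t → [ H⊆P , (λ j≡0 → subst P (sym j≡0) P₀) ] (toWitness {a? = H? j ⊎-dec j ≟ zero} t)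
    ... | D , (H⊆D , D₀ , D⊆P) , prefixed = record
      { member = D
      ; ⊇H     = H⊆D
      ; has-R₀ = D₀
      ; closed = λ Du Dv p>0 → prefixed (closureStep-product D Du Dv p>0)
      ; ⊆P     = D⊆P
      }

  -- Two i-neighbours z, z′ of x are joined by a relation in R_{i*} T Rᵢ ⊆ T,
  -- for every strongly normal closed T, since R₀ ∈ T.
  common-neighbour⇒thin : ThinThinResidue → ∀ {x z z′ i} → r x z ≡ i → r x z′ ≡ i →
                          valency (r z z′) ≡ 1
  common-neighbour⇒thin thin-residue {x} {z} {z′} {i} xz∈i xz′∈i =
    thin-residue (r z z′) λ U (U-closed , U-normal) →
      U-normal i (r z z′)
        ( star i , i
        , (star i , zero , refl , Closed⇒R₀ U-closed , p-unit (star i))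
        , refl , path⇒p>0 (r-flip xz∈i) xz′∈i )

module RegularModule {c ℓ} (𝔽 : Field c ℓ) {p : ℕ} (char : FieldOps.HasCharacteristic 𝔽 p)
                     {n d} (S : AssocScheme n d) (thin-residue : AssocScheme.ThinThinResidue S) where
  open Field 𝔽 hiding (zero; refl) renaming (sym to ≈-sym; trans to ≈-trans)
  open FieldOps 𝔽
  open FieldProperties 𝔽
  open Characteristic char
  open AssocScheme S hiding (p)
  open OverField 𝔽
  open SchemeProperties S
  open import Relation.Binary.Reasoning.Setoid setoid

  Sₚ′ : Fin (suc d) → Set
  Sₚ′ j = ¬ p ∣ valency j

  Sₚ′? : Decidable Sₚ′
  Sₚ′? j = ¬? (p ∣? valency j)

  thin⇒Sₚ′ : ∀ {t} → valency t ≡ 1 → Sₚ′ t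
  thin⇒Sₚ′ thin = subst (λ k → ¬ p ∣ k) (sym thin) p∤1

  ThinInvariant : Mat → Set ℓ
  ThinInvariant w = ∀ {z z′ y} → valency (r z z′) ≡ 1 → w z′ y ≈ w z y

  LeftInvariant : Mat → Fin (suc d) → Set ℓ
  LeftInvariant w j = ∀ {x z y} → r x z ≡ j → w z y ≈ w x y

  adj·-neighbours : ∀ {w i x y a} → (∀ {u} → r x u ≡ i → w u y ≈ a) →
                    (adj i ·M w) x y ≈ ι (valency i) * a
  adj·-neighbours {w} {i} {x} {y} {a} const-on-neighbours = begin
    (adj i ·M w) x y                     ≈⟨ sumF-select (λ u → ⌊ r x u ≟ i ⌋) (λ u → w u y)
                                              (λ u t → const-on-neighbours (toWitness {a? = r x u ≟ i} t)) ⟩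
    ι (count (λ u → ⌊ r x u ≟ i ⌋)) * a  ≡⟨ cong (λ k → ι k * a) (count-neighbours x i) ⟩
    ι (valency i) * a                    ∎

  adj·-thinInvariant : ∀ {w} → ThinInvariant w → ∀ {i x y z} → r x z ≡ i →
                       (adj i ·M w) x y ≈ ι (valency i) * w z y
  adj·-thinInvariant {w} w-inv {y = y} xz∈i =
    adj·-neighbours {w} {y = y} (λ xu∈i → w-inv (common-neighbour⇒thin thin-residue xz∈i xu∈i))

  InFS-classFunction : (g : Fin (suc d) → Carrier) → InFS (λ x y → g (r x y))
  InFS-classFunction g = g , λ x y → begin
    g (r x y)                                                ≈⟨ *-identityˡ _ ⟨
    1# * g (r x y)                                           ≈⟨ *-congʳ ι-1 ⟨
    ι 1 * g (r x y)                                          ≡⟨ cong (λ k → ι k * g (r x y)) (count-≟ (r x y)) ⟨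
    ι (count (λ i → ⌊ r x y ≟ i ⌋)) * g (r x y)              ≈⟨ sumF-select (λ i → ⌊ r x y ≟ i ⌋) g
                                                                  (λ i t → reflexive (cong g (sym (toWitness {a? = r x y ≟ i} t)))) ⟨
    sumF (λ i → (if ⌊ r x y ≟ i ⌋ then 1# else 0#) * g i)    ≈⟨ sumF-cong (λ i → *-comm (adj i x y) (g i)) ⟩
    sumF (λ i → g i * adj i x y)                             ∎

  InFS⇒classFunction : ∀ {w} → InFS w → ∀ {x y x′ y′} → r x y ≡ r x′ y′ → w x y ≈ w x′ y′
  InFS⇒classFunction {w} (a , w≈) {x} {y} {x′} {y′} same = begin
    w x y                           ≈⟨ w≈ x y ⟩
    sumF (λ i → a i * adj i x y)    ≡⟨ cong (λ k → sumF (λ i → a i * (if ⌊ k ≟ i ⌋ then 1# else 0#))) same ⟩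
    sumF (λ i → a i * adj i x′ y′)  ≈⟨ w≈ x′ y′ ⟨
    w x′ y′                         ∎

  trivial⇒thinInvariant : ∀ {w} → TrivialVector w → ThinInvariant w
  trivial⇒thinInvariant {w} (_ , _ , act) {z} {z′} {y} thin = *-cancelˡ (p∤⇒ι≉0 (thin⇒Sₚ′ thin)) (begin
    ι (valency t) * w z′ y  ≈⟨ adj·-neighbours {w} {y = y} only-z′ ⟨
    (adj t ·M w) z y        ≈⟨ act t z y ⟩
    ι (valency t) * w z y   ∎)
    where
    t : Fin (suc d)
    t = r z z′
    only-z′ : ∀ {u} → r z u ≡ t → w u y ≈ w z′ y
    only-z′ zu∈t = reflexive (cong (λ u → w u y) (thin-unique thin zu∈t refl))

  trivial⇒leftInvariant : ∀ {w} → TrivialVector w → ∀ {i} → Sₚ′ i → LeftInvariant w i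
  trivial⇒leftInvariant {w} tw@(_ , _ , act) {i} p∤k {x} {z} {y} xz∈i = *-cancelˡ (p∤⇒ι≉0 p∤k) (begin
    ι (valency i) * w z y  ≈⟨ adj·-thinInvariant {w} (trivial⇒thinInvariant tw) {y = y} xz∈i ⟨
    (adj i ·M w) x y       ≈⟨ act i x y ⟩
    ι (valency i) * w x y  ∎)

  leftInvariant-productClosed : ∀ w → ProductClosed (LeftInvariant w)
  leftInvariant-productClosed w {u} inv-u inv-v p>0 xz∈k with p>0⇒path p>0 xz∈k
  ... | m , xm∈u* , mz∈v = ≈-trans (inv-v mz∈v) (≈-sym (inv-u (trans (r-flip xm∈u*) (star-involutive u))))

  leftInvariant-R₀ : ∀ w → LeftInvariant w zero
  leftInvariant-R₀ w {x} {z} {y} xz∈0 = reflexive (cong (λ u → w u y) (sym (R₀-diag₁ x z xz∈0)))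

  trivial-constant : (∀ i → Generated Sₚ′ i) → ∀ {w} → TrivialVector w → ∀ x y x′ y′ → w x y ≈ w x′ y′
  trivial-constant generated {w} tw x y x′ y′ = begin
    w x y    ≈⟨ left-invariant (r y x) refl ⟩
    w y y    ≈⟨ InFS⇒classFunction (proj₁ tw) (trans (R₀-diag₂ y) (sym (R₀-diag₂ y′))) ⟩
    w y′ y′  ≈⟨ left-invariant (r y′ x′) refl ⟨
    w x′ y′  ∎
    where
    open ClosureWithin (closure-within Sₚ′? (leftInvariant-productClosed w)
                                       (leftInvariant-R₀ w) (trivial⇒leftInvariant tw))
    left-invariant : ∀ j → LeftInvariant w j
    left-invariant j = ⊆P (generated j (T ∘ member) (ProductClosed⇒Closed has-R₀ closed) (λ _ → ⊇H))

  indicator : (Fin (suc d) → Bool) → Mat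
  indicator D x y = if D (r x y) then 1# else 0#

  J : Mat
  J = indicator (λ _ → true)

  module _ {D : Fin (suc d) → Bool} (D₀ : T (D zero)) (closed : ProductClosed (T ∘ D))
           (Sₚ′⊆D : ∀ {j} → Sₚ′ j → T (D j)) where

    indicator-left-invariant : ∀ {x y z} → T (D (r x z)) → indicator D z y ≈ indicator D x y
    indicator-left-invariant Dxz =
      reflexive (cong (λ b → if b then 1# else 0#) (productClosed-left-invariant closed D₀ Dxz))

    indicator-thinInvariant : ThinInvariant (indicator D)
    indicator-thinInvariant {z} {z′} {y} thin =
      indicator-left-invariant {z} {y} {z′} (Sₚ′⊆D (thin⇒Sₚ′ thin))

    indicator-action : ∀ i x y → (adj i ·M indicator D) x y ≈ ι (valency i) * indicator D x y
    indicator-action i x y with neighbour-exists x i | p ∣? valency i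
    ... | z , xz∈i | yes p∣k = ≈-trans (adj·-thinInvariant {indicator D} indicator-thinInvariant {y = y} xz∈i)
                                       (p∣⇒ι*-absorbs p∣k _ _)
    ... | z , xz∈i | no  p∤k = ≈-trans (adj·-thinInvariant {indicator D} indicator-thinInvariant {y = y} xz∈i)
                                       (*-congˡ (indicator-left-invariant {x} {y} {z} Dxz))
      where
      Dxz : T (D (r x z))
      Dxz = subst (T ∘ D) (sym xz∈i) (Sₚ′⊆D p∤k)

    indicator-nonzero : ¬ (∀ x y → indicator D x y ≈ 0#)
    indicator-nonzero all-zero with nonempty zero
    ... | x , _ , _ = 1≉0 (≈-trans (reflexive (sym (if-T (subst (T ∘ D) (sym (R₀-diag₂ x)) D₀))))
                                   (all-zero x x))

    indicator-trivial : TrivialVector (indicator D)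
    indicator-trivial = InFS-classFunction (λ j → if D j then 1# else 0#) , indicator-nonzero , indicator-action

  J-trivial : TrivialVector J
  J-trivial = indicator-trivial tt (λ _ _ _ → tt) (λ _ → tt)

  spans-J⇒constant : ∀ {u v} → SameSpan u v → SameSpan J v → ∀ x y x′ y′ → u x y ≈ u x′ y′
  spans-J⇒constant {u} {v} (⟨u⟩⊆⟨v⟩ , _) (_ , ⟨v⟩⊆⟨J⟩) x y x′ y′ with ⟨u⟩⊆⟨v⟩ 1#
  ... | b , u≈bv with ⟨v⟩⊆⟨J⟩ b
  ...   | a , bv≈aJ = begin
    u x y         ≈⟨ *-identityˡ _ ⟨
    1# * u x y    ≈⟨ u≈bv x y ⟩
    b * v x y     ≈⟨ bv≈aJ x y ⟩
    a * 1#        ≈⟨ bv≈aJ x′ y′ ⟨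
    b * v x′ y′   ≈⟨ u≈bv x′ y′ ⟨
    1# * u x′ y′  ≈⟨ *-identityˡ _ ⟩
    u x′ y′       ∎

  constant⇒SameSpan-J : ∀ {w a} → ¬ a ≈ 0# → (∀ x y → w x y ≈ a) → SameSpan w J
  constant⇒SameSpan-J {w} {a} a≉0 w≈a with inverse a a≉0
  ... | a⁻¹ , aa⁻¹≈1 =
      (λ b → b * a , λ x y → ≈-trans (*-congˡ (w≈a x y)) (≈-sym (*-identityʳ _)))
    , (λ b → b * a⁻¹ , λ x y → begin
        b * 1#             ≈⟨ *-congˡ aa⁻¹≈1 ⟨
        b * (a * a⁻¹)      ≈⟨ *-congˡ (*-comm a a⁻¹) ⟩
        b * (a⁻¹ * a)      ≈⟨ *-assoc b a⁻¹ a ⟨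
        (b * a⁻¹) * a      ≈⟨ *-congˡ (w≈a x y) ⟨
        (b * a⁻¹) * w x y  ∎)

  pTransitive⇒generated : PTransitive → ∀ i → Generated Sₚ′ i
  pTransitive⇒generated (_ , _ , unique) i U U-closed Sₚ′⊆U = ⊆P (member-everywhere i)
    where
    open ClosureWithin (closure-within Sₚ′? (Closed⇒ProductClosed U-closed)
                                       (Closed⇒R₀ U-closed) (Sₚ′⊆U _))
    constant : ∀ x y x′ y′ → indicator member x y ≈ indicator member x′ y′
    constant = spans-J⇒constant (unique _ (indicator-trivial has-R₀ closed ⊇H)) (unique J J-trivial)

    member-everywhere : ∀ j → T (member j)
    member-everywhere j with nonempty j
    ... | x , y , refl = decidable-stable (T? (member (r x y))) λ xy∉ → 1≉0 (begin
      1#                    ≡⟨ if-T (subst (T ∘ member) (sym (R₀-diag₂ x)) has-R₀) ⟨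
      indicator member x x  ≈⟨ constant x x x y ⟩
      indicator member x y  ≡⟨ if-¬T xy∉ ⟩
      0#                    ∎)

  generated⇒pTransitive : (∀ i → Generated Sₚ′ i) → PTransitive
  generated⇒pTransitive generated = J , J-trivial , spanned
    where
    spanned : ∀ w → TrivialVector w → SameSpan w J
    spanned w tw with nonempty zero
    ... | x₀ , _ , _ = constant⇒SameSpan-J w₀≉0 (λ x y → constant x y x₀ x₀)
      where
      constant : ∀ x y x′ y′ → w x y ≈ w x′ y′
      constant = trivial-constant generated tw
      w₀≉0 : ¬ w x₀ x₀ ≈ 0#
      w₀≉0 w₀≈0 = proj₁ (proj₂ tw) (λ x y → ≈-trans (constant x y x₀ x₀) w₀≈0)

theoremB : {c ℓ : Level} (F : Field c ℓ) (p : ℕ) →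
    FieldOps.HasCharacteristic F p →
    (n d : ℕ) → 0 < n → (S : AssocScheme n d) →
    AssocScheme.ThinThinResidue S →
    AssocScheme.OverField.PTransitive S F
    ⇔ (∀ i → AssocScheme.Generated S (λ j → ¬ (p ∣ AssocScheme.valency S j)) i)
theoremB F p char n d _ S thin-residue = mk⇔ pTransitive⇒generated generated⇒pTransitive
  where open RegularModule F char S thin-residue
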